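{- Let $G=(V,A)$ be a finite simple directed graph without loops and let $k\ge 2$ be an integer. Suppose $G$ contains no $k$-long arcs. Let $V/C_k$ be the set of equivalence classes of the cyclic $k$-gonal connectivity relation $C_k$, and define the reduction $G/C_k=(V/C_k,A^*)$ where for distinct $X,Y\in V/C_k$, $(X,Y)\in A^*$ iff there exist $u\in X$, $v\in Y$ with $(u,v)\in A$. Then $G/C_k$ is acyclic (contains no directed cycle).
   Context: A $(k)$-cycle of $G$ is a directed cycle of length at least 2 and at most $k$. $u\,C_k\,v$ iff $u=v$ or there is a sequence $(C_1,\dots,C_s)$ of $(k)$-cycles with $u\in V(C_1)$, $v\in V(C_s)$ and $V(C_{i-1})\cap V(C_i)\neq\emptyset$ for $i=2,\dots,s$; this is an equivalence relation on $V$. An arc is cyclic if it belongs to some directed cycle (of any length) of $G$; a $k$-long arc is a cyclic arc that does not belong to any $(k)$-cycle. -}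

module Defs where

open import Data.Nat using (ℕ; zero; suc; _≤_)
open import Data.Fin using (Fin; zero; suc)
import Data.Fin
open import Data.Bool using (Bool; true; false; T)
open import Data.Product using (Σ; ∃; _×_; _,_)
open import Data.Sum using (_⊎_)
open import Relation.Nullary using (¬_)
open import Relation.Binary.PropositionalEquality using (_≡_)
open import Function.Definitions using (Injective)

sucMod : ∀ {l} → Fin l → Fin l
sucMod {suc zero} zero = zero
sucMod {suc (suc l)} zero = suc zero
sucMod {suc (suc l)} (suc i) with sucMod {suc l} i
... | zero = zero
... | suc j = suc (suc j)

-- A finite simple digraph on vertex set Fin n: the arc set A ⊆ V × V is
-- given by its (Boolean) adjacency matrix; loop-freeness is a separate hypothesis.
Digraph : ℕ → Set
Digraph n = Fin n → Fin n → Bool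

Arc : ∀ {n} → Digraph n → Fin n → Fin n → Set
Arc G u v = T (G u v)

Loopless : ∀ {n} → Digraph n → Set
Loopless G = ∀ u → G u u ≡ false

record Cycle {n} (G : Digraph n) : Set where
  field
    len   : ℕ
    len≥2 : 2 ≤ len
    vert  : Fin len → Fin n
    inj   : Injective _≡_ _≡_ vert
    arcs  : ∀ i → Arc G (vert i) (vert (sucMod i))
open Cycle public

KCycle : ∀ {n} → Digraph n → ℕ → Set
KCycle G k = Σ (Cycle G) λ C → len C ≤ k

_∈V_ : ∀ {n} {G : Digraph n} → Fin n → Cycle G → Set
v ∈V C = ∃ λ i → vert C i ≡ v

ArcOf : ∀ {n} {G : Digraph n} → Fin n → Fin n → Cycle G → Set
ArcOf u v C = ∃ λ i → (vert C i ≡ u) × (vert C (sucMod i) ≡ v)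

-- u C_k v : u = v or a chain C_1,…,C_s (s ≥ 1, indexed by Fin (suc m))
-- of (k)-cycles with u ∈ V(C_1), v ∈ V(C_s), consecutive ones sharing a vertex.
Ck : ∀ {n} → Digraph n → ℕ → Fin n → Fin n → Set
Ck {n} G k u v =
  (u ≡ v) ⊎
  (Σ ℕ λ m → Σ (Fin (suc m) → KCycle G k) λ Cs →
     (u ∈V Σ.proj₁ (Cs zero)) ×
     (v ∈V Σ.proj₁ (Cs (Data.Fin.fromℕ m))) ×
     (∀ (i : Fin m) → ∃ λ w →
        (w ∈V Σ.proj₁ (Cs (Data.Fin.inject₁ i))) × (w ∈V Σ.proj₁ (Cs (suc i)))))

CyclicArc : ∀ {n} → Digraph n → Fin n → Fin n → Set
CyclicArc G u v = Arc G u v × ∃ λ (C : Cycle G) → ArcOf u v C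

KLongArc : ∀ {n} → Digraph n → ℕ → Fin n → Fin n → Set
KLongArc G k u v = CyclicArc G u v × ¬ (∃ λ (C : KCycle G k) → ArcOf u v (Σ.proj₁ C))

-- Arcs of the reduction G/C_k between the classes [x] and [y] (x, y class
-- representatives; classes distinct is imposed where used):
-- some u ∈ [x], v ∈ [y] with (u,v) ∈ A.
RedArc : ∀ {n} → Digraph n → ℕ → Fin n → Fin n → Set
RedArc G k x y = ∃ λ u → ∃ λ v → Ck G k x u × Ck G k y v × Arc G u v

-- A directed cycle in G/C_k, given by representatives r 0 … r (len-1) of
-- pairwise distinct classes (len ≥ 2), with A*-arcs [r i] → [r (i+1 mod len)].
record RedCycle {n} (G : Digraph n) (k : ℕ) : Set where
  field
    rlen   : ℕ
    rlen≥2 : 2 ≤ rlen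
    rep    : Fin rlen → Fin n
    distinct : ∀ i j → Ck G k (rep i) (rep j) → i ≡ j
    rarcs  : ∀ i → RedArc G k (rep i) (rep (sucMod i))

{-# OPTIONS --safe #-}
-- Every C_k-class is strongly connected, because every (k)-cycle is; hence an
-- arc [x] → [y] of G/C_k that lies on a directed cycle of G/C_k lifts to an
-- arc u → v of G together with a walk from v back to u, i.e. to a cyclic arc
-- of G.  As G has no k-long arcs, u → v lies on a (k)-cycle, so u C_k v and
-- therefore x C_k y, contradicting that the classes on a cycle are distinct.
module Submission where

open import Defs
open import Data.Nat using (ℕ; zero; suc; _≤_; s≤s; z≤n)
open import Data.Fin using (Fin; zero; suc; fromℕ; inject₁)
open import Data.Fin.Properties using (_≟_; 0≢1+n)
open import Data.Fin.Induction using (<-weakInduction; >-weakInduction)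
open import Data.Bool using (T)
open import Data.Product using (∃; _×_; _,_; proj₁)
open import Data.Sum using (_⊎_; inj₁; inj₂)
open import Data.Vec using (Vec; []; _∷_; lookup)
open import Data.Vec.Relation.Unary.Any using (here; there)
open import Data.Vec.Membership.Propositional using (_∈_; _∉_)
open import Data.Vec.Membership.Propositional.Properties using (∈-lookup)
open import Function using (_∘_)
open import Function.Definitions using (Injective)
open import Relation.Binary.Core using (Rel)
open import Relation.Binary.Definitions using (Symmetric; Transitive)
open import Relation.Binary.Construct.Closure.ReflexiveTransitive
  using (Star; ε; _◅_; _◅◅_; _⋆; fold; reverse)
open import Relation.Binary.PropositionalEquality
  using (_≡_; _≢_; refl; sym; trans; cong; subst; subst₂; ≢-sym)
open import Relation.Nullary using (¬_; yes; no; contradiction)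

sucMod-fromℕ : ∀ L → sucMod (fromℕ L) ≡ zero
sucMod-fromℕ zero = refl
sucMod-fromℕ (suc L) rewrite sucMod-fromℕ L = refl

sucMod-inject₁ : ∀ {L} (i : Fin L) → sucMod (inject₁ i) ≡ suc i
sucMod-inject₁ {suc L} zero = refl
sucMod-inject₁ {suc L} (suc i) rewrite sucMod-inject₁ i = refl

fromℕ-or-inject₁ : ∀ {L} (i : Fin (suc L)) → i ≡ fromℕ L ⊎ ∃ λ j → i ≡ inject₁ j
fromℕ-or-inject₁ {zero} zero = inj₁ refl
fromℕ-or-inject₁ {suc L} zero = inj₂ (zero , refl)
fromℕ-or-inject₁ {suc L} (suc i) with fromℕ-or-inject₁ i
... | inj₁ i≡last = inj₁ (cong suc i≡last)
... | inj₂ (j , i≡j) = inj₂ (suc j , cong suc i≡j)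

module _ {a r} {A : Set a} {R : Rel A r} where

  cyclic-connected : ∀ {len} (f : Fin len → A) → (∀ i → R (f i) (f (sucMod i))) →
                     ∀ i j → Star R (f i) (f j)
  cyclic-connected {suc L} f step i j = toLast i ◅◅ wrap ◅ fromZero j
    where
      forward : ∀ i → R (f (inject₁ i)) (f (suc i))
      forward i = subst (R (f (inject₁ i)) ∘ f) (sucMod-inject₁ i) (step (inject₁ i))

      wrap : R (f (fromℕ L)) (f zero)
      wrap = subst (R (f (fromℕ L)) ∘ f) (sucMod-fromℕ L) (step (fromℕ L))

      toLast : ∀ i → Star R (f i) (f (fromℕ L))
      toLast = >-weakInduction (λ i → Star R (f i) (f (fromℕ L))) ε (λ i p → forward i ◅ p)

      fromZero : ∀ j → Star R (f zero) (f j)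
      fromZero = <-weakInduction (λ j → Star R (f zero) (f j)) ε (λ j p → p ◅◅ forward j ◅ ε)

Walk : ∀ {n} → Digraph n → Rel (Fin n) _
Walk G = Star (Arc G)

module _ {n} (G : Digraph n) where
  open import Data.Vec.Membership.DecPropositional (_≟_ {n}) using (_∈?_)

  private
    variable
      a b c : Fin n
      L : ℕ
      vs : Vec (Fin n) (suc L)

  data IsSimplePath : ∀ {L} → Fin n → Fin n → Vec (Fin n) (suc L) → Set where
    [-]  : ∀ {c} → IsSimplePath c c (c ∷ [])
    cons : ∀ {a b c L} {vs : Vec (Fin n) (suc L)} →
           Arc G a b → IsSimplePath b c vs → a ∉ vs → IsSimplePath a c (a ∷ vs)

  SimplePath : Fin n → Fin n → Set
  SimplePath a c = ∃ λ L → ∃ λ (vs : Vec (Fin n) (suc L)) → IsSimplePath a c vs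

  suffix : IsSimplePath b c vs → a ∈ vs → SimplePath a c
  suffix [-]            (here refl) = _ , _ , [-]
  suffix p@(cons _ _ _) (here refl) = _ , _ , p
  suffix (cons _ p _)   (there a∈vs) = suffix p a∈vs

  walk⇒simplePath : Walk G a c → SimplePath a c
  walk⇒simplePath ε = _ , _ , [-]
  walk⇒simplePath (_◅_ {a} a→b b⇝c) with walk⇒simplePath b⇝c
  ... | _ , vs , p with a ∈? vs
  ...   | yes a∈vs = suffix p a∈vs
  ...   | no  a∉vs = _ , _ , cons a→b p a∉vs

  simple-head : IsSimplePath a c vs → lookup vs zero ≡ a
  simple-head [-]          = refl
  simple-head (cons _ _ _) = refl

  simple-last : IsSimplePath a c vs → lookup vs (fromℕ L) ≡ c
  simple-last [-]          = refl
  simple-last (cons _ p _) = simple-last p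

  simple-arc : IsSimplePath a c vs → ∀ j → Arc G (lookup vs (inject₁ j)) (lookup vs (suc j))
  simple-arc (cons a→b p _) zero    = subst (Arc G _) (sym (simple-head p)) a→b
  simple-arc (cons _   p _) (suc j) = simple-arc p j

  simple-injective : IsSimplePath a c vs → Injective _≡_ _≡_ (lookup vs)
  simple-injective [-] {zero} {zero} _ = refl
  simple-injective (cons _ _ _) {zero} {zero} _ = refl
  simple-injective (cons {vs = ws} _ _ a∉ws) {zero} {suc j} a≡wⱼ =
    contradiction (subst (_∈ ws) (sym a≡wⱼ) (∈-lookup j ws)) a∉ws
  simple-injective (cons {vs = ws} _ _ a∉ws) {suc i} {zero} wᵢ≡a =
    contradiction (subst (_∈ ws) wᵢ≡a (∈-lookup i ws)) a∉ws
  simple-injective (cons _ p _) {suc i} {suc j} wᵢ≡wⱼ = cong suc (simple-injective p wᵢ≡wⱼ)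

  closingArc⇒Cycle : IsSimplePath a c vs → Arc G c a → a ≢ c → ∃ λ (C : Cycle G) → ArcOf c a C
  closingArc⇒Cycle [-] _ a≢a = contradiction refl a≢a
  closingArc⇒Cycle {a = a} {vs = vs} p@(cons {L = M} _ _ _) c→a _ =
    record { len = suc (suc M) ; len≥2 = s≤s (s≤s z≤n) ; vert = lookup vs
           ; inj = simple-injective p ; arcs = around }
    , fromℕ (suc M) , simple-last p , closes
    where
      closes : lookup vs (sucMod (fromℕ (suc M))) ≡ a
      closes = trans (cong (lookup vs) (sucMod-fromℕ (suc M))) (simple-head p)

      around : ∀ i → Arc G (lookup vs i) (lookup vs (sucMod i))
      around i with fromℕ-or-inject₁ i
      ... | inj₁ refl       = subst₂ (Arc G) (sym (simple-last p)) (sym closes) c→a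
      ... | inj₂ (j , refl) =
        subst (Arc G (lookup vs (inject₁ j)) ∘ lookup vs) (sym (sucMod-inject₁ j)) (simple-arc p j)

  loopless⇒arc-irreflexive : Loopless G → ∀ {u v} → Arc G u v → u ≢ v
  loopless⇒arc-irreflexive loopless {u} u→u refl = subst T (loopless u) u→u

  returningArc⇒cyclicArc : Loopless G → ∀ {u v} → Arc G u v → Walk G v u → CyclicArc G u v
  returningArc⇒cyclicArc loopless u→v v⇝u with walk⇒simplePath v⇝u
  ... | _ , _ , p = u→v , closingArc⇒Cycle p u→v (≢-sym (loopless⇒arc-irreflexive loopless u→v))

module _ {n} (G : Digraph n) (k : ℕ) where

  OnCommonKCycle : Rel (Fin n) _
  OnCommonKCycle u v = ∃ λ (C : KCycle G k) → u ∈V proj₁ C × v ∈V proj₁ C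

  onCommonKCycle-sym : Symmetric OnCommonKCycle
  onCommonKCycle-sym (C , u∈C , v∈C) = C , v∈C , u∈C

  onCommonKCycle⇒walk : ∀ {u v} → OnCommonKCycle u v → Walk G u v
  onCommonKCycle⇒walk ((C , _) , (i , refl) , (j , refl)) = cyclic-connected (vert C) (arcs C) i j

  Ck⇒Star : ∀ {u v} → Ck G k u v → Star OnCommonKCycle u v
  Ck⇒Star (inj₁ refl) = ε
  Ck⇒Star (inj₂ (m , Cs , u∈C₀ , v∈Cₘ , links)) = chain m Cs u∈C₀ v∈Cₘ links
    where
      chain : ∀ m (Cs : Fin (suc m) → KCycle G k) {u v} →
              u ∈V proj₁ (Cs zero) → v ∈V proj₁ (Cs (fromℕ m)) →
              (∀ i → ∃ λ w → w ∈V proj₁ (Cs (inject₁ i)) × w ∈V proj₁ (Cs (suc i))) →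
              Star OnCommonKCycle u v
      chain zero    Cs u∈C₀ v∈C₀ _ = (Cs zero , u∈C₀ , v∈C₀) ◅ ε
      chain (suc m) Cs u∈C₀ v∈Cₘ links with links zero
      ... | w , w∈C₀ , w∈C₁ = (Cs zero , u∈C₀ , w∈C₀) ◅ chain m (Cs ∘ suc) w∈C₁ v∈Cₘ (links ∘ suc)

  Ck-cons : ∀ {u w v} → OnCommonKCycle u w → Ck G k w v → Ck G k u v
  Ck-cons (C , u∈C , w∈C) (inj₁ refl) = inj₂ (0 , (λ _ → C) , u∈C , w∈C , λ ())
  Ck-cons (C , u∈C , w∈C) (inj₂ (m , Cs , w∈C₀ , v∈Cₘ , links)) =
    inj₂ (suc m , Cs′ , u∈C , v∈Cₘ , links′)
    where
      Cs′ : Fin (suc (suc m)) → KCycle G k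
      Cs′ zero    = C
      Cs′ (suc i) = Cs i

      links′ : ∀ i → ∃ λ x → x ∈V proj₁ (Cs′ (inject₁ i)) × x ∈V proj₁ (Cs′ (suc i))
      links′ zero    = _ , w∈C , w∈C₀
      links′ (suc i) = links i

  Star⇒Ck : ∀ {u v} → Star OnCommonKCycle u v → Ck G k u v
  Star⇒Ck = fold (Ck G k) Ck-cons (inj₁ refl)

  Ck-sym : Symmetric (Ck G k)
  Ck-sym = Star⇒Ck ∘ reverse onCommonKCycle-sym ∘ Ck⇒Star

  Ck-trans : Transitive (Ck G k)
  Ck-trans u~v v~w = Star⇒Ck (Ck⇒Star u~v ◅◅ Ck⇒Star v~w)

  Ck⇒walk : ∀ {u v} → Ck G k u v → Walk G u v
  Ck⇒walk = (onCommonKCycle⇒walk ⋆) ∘ Ck⇒Star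

  kCycleArc⇒Ck : ∀ {u v} (C : KCycle G k) → ArcOf u v (proj₁ C) → Ck G k u v
  kCycleArc⇒Ck C (i , refl , refl) = Star⇒Ck ((C , (i , refl) , (sucMod i , refl)) ◅ ε)

  redArc⇒walk : ∀ {x y} → RedArc G k x y → Walk G x y
  redArc⇒walk (_ , _ , x~u , y~v , u→v) = Ck⇒walk x~u ◅◅ u→v ◅ Ck⇒walk (Ck-sym y~v)

  -- Only ¬¬: the absence of k-long arcs refutes that a cyclic arc avoids every
  -- (k)-cycle, but does not exhibit one through it.
  returningRedArc⇒¬¬Ck : Loopless G → ¬ (∃ λ u → ∃ λ v → KLongArc G k u v) →
                         ∀ {x y} → RedArc G k x y → Walk G y x → ¬ ¬ Ck G k x y
  returningRedArc⇒¬¬Ck loopless noLongArc (u , v , x~u , y~v , u→v) y⇝x x≁y =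
    noLongArc (u , v , returningArc⇒cyclicArc G loopless u→v v⇝u , onNoKCycle)
    where
      v⇝u : Walk G v u
      v⇝u = Ck⇒walk (Ck-sym y~v) ◅◅ y⇝x ◅◅ Ck⇒walk x~u

      onNoKCycle : ¬ (∃ λ (C : KCycle G k) → ArcOf u v (proj₁ C))
      onNoKCycle (C , uv∈C) = x≁y (Ck-trans x~u (Ck-trans (kCycleArc⇒Ck C uv∈C) (Ck-sym y~v)))

-- The argument does not use 2 ≤ k.
theorem16 : (n : ℕ) (G : Digraph n) (k : ℕ) → Loopless G → 2 ≤ k →
    ¬ (∃ λ u → ∃ λ v → KLongArc G k u v) →
    ¬ RedCycle G k
theorem16 n G k loopless _ noLongArc
  record { rlen≥2 = s≤s (s≤s _) ; rep = rep ; distinct = distinct ; rarcs = rarcs } =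
  returningRedArc⇒¬¬Ck G k loopless noLongArc (rarcs zero) r₁⇝r₀
    (0≢1+n ∘ distinct zero (suc zero))
  where
    r₁⇝r₀ : Walk G (rep (suc zero)) (rep zero)
    r₁⇝r₀ = (redArc⇒walk G k ⋆) (cyclic-connected rep rarcs (suc zero) zero)
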